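{- Let $B$ be a finite (simple, undirected) bipartite graph. Then there exist a set $A$ of non-negative even integers and a set $O$ of positive odd integers such that the odd-even graph $\mathcal{G}_A(O)$ is isomorphic to $B$.
   Context: For a set $A$ of non-negative even integers and a set $O$ of positive odd integers, the odd-even graph $\mathcal{G}_A(O)$ is the simple undirected graph with vertex set $A$ in which distinct $a,b\in A$ are adjacent iff both $\frac{a+b}{2}$ and $\frac{|a-b|}{2}$ belong to $O$. -}

module Defs where

open import Data.Nat using (ℕ; _+_; _*_; _∸_; _⊔_; _⊓_; suc; _≤_)
open import Data.Nat.Base using (∣_-_∣)
open import Data.Fin using (Fin)
open import Data.Bool using (Bool)
open import Data.Product using (Σ; _×_; ∃)
open import Relation.Binary.PropositionalEquality using (_≡_; _≢_)
open import Relation.Nullary using (¬_)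

record Graph (n : ℕ) : Set₁ where
  field
    Adj   : Fin n → Fin n → Set
    sym   : ∀ {i j} → Adj i j → Adj j i
    irrefl : ∀ {i} → ¬ Adj i i
open Graph public

Bipartite : ∀ {n} → Graph n → Set
Bipartite {n} G = Σ (Fin n → Bool) λ c → ∀ {i j} → Adj G i j → c i ≢ c j

Even : ℕ → Set
Even m = Σ ℕ λ k → m ≡ 2 * k

Odd : ℕ → Set
Odd m = Σ ℕ λ k → m ≡ suc (2 * k)

OEAdj : (O : ℕ → Set) → ℕ → ℕ → Set
OEAdj O a b = (a ≢ b) × Σ ℕ λ s → Σ ℕ λ d →
  (a + b ≡ 2 * s) × (∣ a - b ∣ ≡ 2 * d) × O s × O d

Elem : (ℕ → Set) → Set
Elem A = Σ ℕ A

-- B ≅ G_A(O): a map f : Fin n → ℕ that is a bijection onto A (values in A,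
-- injective, every element of A is hit) and preserves and reflects adjacency.
-- (Stated on underlying numbers so that it does not depend on the proofs of
-- membership in A.)
IsoOE : ∀ {n} → Graph n → (A O : ℕ → Set) → Set
IsoOE {n} B A O = Σ (Fin n → ℕ) λ f →
    (∀ i → A (f i))
  × (∀ i j → f i ≡ f j → i ≡ j)
  × (∀ a → A a → Σ (Fin n) λ i → f i ≡ a)
  × (∀ i j → (Adj B i j → OEAdj O (f i) (f j)) × (OEAdj O (f i) (f j) → Adj B i j))

module Submission where

-- Give vertex i the weight xᵢ = c(i) + 2·4^(i+1), whose parity records its colour c(i),
-- place it at the even number 2xᵢ, and let O consist of xₖ + xₗ and |xₖ − xₗ| for all
-- edges kl; these are odd because adjacent vertices have different colours. Every
-- weight exceeds three times each earlier one, so a sum of two weights determines the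
-- pair, and it never equals the difference of two distinct weights. Hence xᵢ + xⱼ ∈ O
-- already forces ij to be an edge.

open import Defs hiding (sym)
open import Data.Nat using (ℕ; zero; suc; _+_; _*_; _^_; _≤_; _<_; z≤n; s≤s)
open import Data.Nat.Base using (∣_-_∣)
open import Data.Nat.Properties
open import Data.Nat.Tactic.RingSolver using (solve-∀)
open import Data.Fin using (Fin; toℕ) renaming (_<_ to _<ᶠ_; _≤_ to _≤ᶠ_)
import Data.Fin.Properties as Fin
open import Data.Bool using (Bool; true; false)
open import Data.Product using (Σ; _×_; _,_; swap)
open import Data.Sum using (_⊎_; inj₁; inj₂)
open import Data.Empty using (⊥-elim)
open import Function using (_∘_)
open import Relation.Binary using (tri<; tri≈; tri>)
open import Relation.Binary.PropositionalEquality
  using (_≡_; _≢_; refl; sym; trans; cong; cong₂; subst)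

sum-of-three-< : ∀ a b c {m} → 3 * a < m → 3 * b < m → 3 * c < m → a + b + c < m
sum-of-three-< a b c {m} 3a<m 3b<m 3c<m =
  *-cancelˡ-< 3 (a + b + c) m (begin-strict
    3 * (a + b + c)       ≡⟨ distrib a b c ⟩
    3 * a + 3 * b + 3 * c <⟨ +-mono-< (+-mono-< 3a<m 3b<m) 3c<m ⟩
    m + m + m             ≡⟨ triple m ⟩
    3 * m                 ∎)
  where
  open ≤-Reasoning
  distrib : ∀ a b c → 3 * (a + b + c) ≡ 3 * a + 3 * b + 3 * c
  distrib = solve-∀
  triple : ∀ m → m + m + m ≡ 3 * m
  triple = solve-∀

m≤n⇒∣m-n∣+m≡n : ∀ {m n} → m ≤ n → ∣ m - n ∣ + m ≡ n
m≤n⇒∣m-n∣+m≡n {m} m≤n = trans (cong (_+ m) (m≤n⇒∣m-n∣≡n∸m m≤n)) (m∸n+n≡m m≤n)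

halve-sum : ∀ m n {s} → 2 * m + 2 * n ≡ 2 * s → m + n ≡ s
halve-sum m n {s} e = *-cancelˡ-≡ (m + n) s 2 (trans (*-distribˡ-+ 2 m n) e)

bit : Bool → ℕ
bit true  = 1
bit false = 0

bit≤1 : ∀ b → bit b ≤ 1
bit≤1 true  = s≤s z≤n
bit≤1 false = z≤n

bit+2*4^-positive : ∀ b m → 0 < bit b + 2 * 4 ^ suc m
bit+2*4^-positive b m =
  ≤-trans (<-≤-trans (m^n>0 4 (suc m)) (m≤n*m _ 2)) (m≤n+m _ (bit b))

bit+2*4^-dominant : ∀ b b' {m n} → m < n →
  3 * (bit b + 2 * 4 ^ suc m) < bit b' + 2 * 4 ^ suc n
bit+2*4^-dominant b b' {m} {n} m<n = begin
  suc (3 * (bit b + 2 * p)) ≤⟨ s≤s (*-monoʳ-≤ 3 (+-monoˡ-≤ (2 * p) (bit≤1 b))) ⟩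
  suc (3 * (1 + 2 * p))     ≡⟨ expand p ⟩
  4 + 6 * p                 ≤⟨ +-monoˡ-≤ (6 * p) (≤-trans 4≤p (m≤n*m p 2)) ⟩
  2 * p + 6 * p             ≡⟨ collect p ⟩
  2 * 4 ^ suc (suc m)       ≤⟨ *-monoʳ-≤ 2 (^-monoʳ-≤ 4 (s≤s m<n)) ⟩
  2 * 4 ^ suc n             ≤⟨ m≤n+m _ (bit b') ⟩
  bit b' + 2 * 4 ^ suc n    ∎
  where
  open ≤-Reasoning
  p : ℕ
  p = 4 ^ suc m
  4≤p : 4 ≤ p
  4≤p = *-monoʳ-≤ 4 (m^n>0 4 m)
  expand : ∀ p → suc (3 * (1 + 2 * p)) ≡ 4 + 6 * p
  expand = solve-∀
  collect : ∀ p → 2 * p + 6 * p ≡ 2 * (4 * p)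
  collect = solve-∀

Parity : Bool → ℕ → Set
Parity true  = Odd
Parity false = Even

bit+2*-parity : ∀ b p → Parity b (bit b + 2 * p)
bit+2*-parity true  p = p , refl
bit+2*-parity false p = p , refl

odd+even-odd : ∀ {m n} → Odd m → Even n → Odd (m + n)
odd+even-odd (k , refl) (j , refl) = k + j , cong suc (sym (*-distribˡ-+ 2 k j))

∣odd-even∣-odd : ∀ k j → Odd ∣ suc (2 * k) - 2 * j ∣
∣odd-even∣-odd zero    zero    = 0 , refl
∣odd-even∣-odd zero    (suc j) = j , +-suc j (j + 0)
∣odd-even∣-odd (suc k) zero    = suc k , refl
∣odd-even∣-odd (suc k) (suc j) =
  subst Odd (cong₂ (λ u v → ∣ suc u - v ∣) (sym (*-suc 2 k)) (sym (*-suc 2 j)))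
    (∣odd-even∣-odd k j)

opposite-parities⇒sum-odd : ∀ {b b' m n} → b ≢ b' → Parity b m → Parity b' n → Odd (m + n)
opposite-parities⇒sum-odd {true}  {true}  b≢b' _ _ = ⊥-elim (b≢b' refl)
opposite-parities⇒sum-odd {true}  {false} _ pm pn = odd+even-odd pm pn
opposite-parities⇒sum-odd {false} {true}  {m} {n} _ pm pn =
  subst Odd (+-comm n m) (odd+even-odd pn pm)
opposite-parities⇒sum-odd {false} {false} b≢b' _ _ = ⊥-elim (b≢b' refl)

opposite-parities⇒∣-∣-odd : ∀ {b b' m n} → b ≢ b' → Parity b m → Parity b' n → Odd ∣ m - n ∣
opposite-parities⇒∣-∣-odd {true}  {true}  b≢b' _ _ = ⊥-elim (b≢b' refl)
opposite-parities⇒∣-∣-odd {true}  {false} _ (k , refl) (j , refl) = ∣odd-even∣-odd k j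
opposite-parities⇒∣-∣-odd {false} {true}  _ (k , refl) (j , refl) =
  subst Odd (∣-∣-comm (suc (2 * j)) (2 * k)) (∣odd-even∣-odd j k)
opposite-parities⇒∣-∣-odd {false} {false} b≢b' _ _ = ⊥-elim (b≢b' refl)

odd⇒positive : ∀ {m} → Odd m → 0 < m
odd⇒positive (_ , refl) = s≤s z≤n

-- Positivity is needed: with x₀ = 0 one would have x₁ + x₀ = ∣ x₀ - x₁ ∣.
module Dominant {n : ℕ} (x : Fin n → ℕ)
                (positive : ∀ i → 0 < x i)
                (dominant : ∀ {i j} → i <ᶠ j → 3 * x i < x j) where

  increasing : ∀ {i j} → i <ᶠ j → x i < x j
  increasing {i} i<j = ≤-<-trans (m≤n*m (x i) 3) (dominant i<j)

  x<⇒< : ∀ {i j} → x i < x j → i <ᶠ j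
  x<⇒< {i} {j} xi<xj with Fin.<-cmp i j
  ... | tri< i<j _ _ = i<j
  ... | tri≈ _ refl _ = ⊥-elim (<-irrefl refl xi<xj)
  ... | tri> _ _ j<i = ⊥-elim (<-asym xi<xj (increasing j<i))

  injective : ∀ {i j} → x i ≡ x j → i ≡ j
  injective {i} {j} xi≡xj with Fin.<-cmp i j
  ... | tri< i<j _ _ = ⊥-elim (<⇒≢ (increasing i<j) xi≡xj)
  ... | tri≈ _ i≡j _ = i≡j
  ... | tri> _ _ j<i = ⊥-elim (<⇒≢ (increasing j<i) (sym xi≡xj))

  sum-<-larger : ∀ {i j l} → i <ᶠ l → j <ᶠ l → x i + x j < x l
  sum-<-larger {i} {j} {l} i<l j<l =
    subst (_< x l) (+-identityʳ (x i + x j))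
      (sum-of-three-< (x i) (x j) 0 (dominant i<l) (dominant j<l) (positive l))

  sum-<-sum : ∀ {i j k l} → i ≤ᶠ j → j <ᶠ l → x i + x j < x k + x l
  sum-<-sum {k = k} {l} i≤j j<l =
    <-≤-trans (sum-<-larger (≤-<-trans i≤j j<l) j<l) (m≤n+m (x l) (x k))

  sorted-sum-injective : ∀ {i j k l} → i ≤ᶠ j → k ≤ᶠ l →
    x i + x j ≡ x k + x l → i ≡ k × j ≡ l
  sorted-sum-injective {i} {j} {k} {l} i≤j k≤l e with Fin.<-cmp j l
  ... | tri< j<l _ _ = ⊥-elim (<-irrefl e (sum-<-sum i≤j j<l))
  ... | tri≈ _ refl _ = injective (+-cancelʳ-≡ (x j) (x i) (x k) e) , refl
  ... | tri> _ _ l<j = ⊥-elim (<-irrefl (sym e) (sum-<-sum k≤l l<j))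

  sum-injective : ∀ {i j k l} → x i + x j ≡ x k + x l → (i ≡ k × j ≡ l) ⊎ (i ≡ l × j ≡ k)
  sum-injective {i} {j} {k} {l} e with Fin.≤-total i j | Fin.≤-total k l
  ... | inj₁ i≤j | inj₁ k≤l = inj₁ (sorted-sum-injective i≤j k≤l e)
  ... | inj₁ i≤j | inj₂ l≤k =
    inj₂ (sorted-sum-injective i≤j l≤k (trans e (+-comm (x k) (x l))))
  ... | inj₂ j≤i | inj₁ k≤l =
    inj₂ (swap (sorted-sum-injective j≤i k≤l (trans (+-comm (x j) (x i)) e)))
  ... | inj₂ j≤i | inj₂ l≤k =
    inj₁ (swap (sorted-sum-injective j≤i l≤k
      (trans (+-comm (x j) (x i)) (trans e (+-comm (x k) (x l))))))

  sum-of-three≢larger : ∀ {i j k l} → k <ᶠ l → x i + x j + x k ≢ x l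
  sum-of-three≢larger {i} {j} {k} {l} k<l e =
    <-irrefl e (sum-of-three-< (x i) (x j) (x k) (dominant i<l) (dominant j<l) (dominant k<l))
    where
    xi+xj<sum : x i + x j < x i + x j + x k
    xi+xj<sum = m<m+n (x i + x j) (positive k)
    i<l : i <ᶠ l
    i<l = x<⇒< (subst (x i <_) e (≤-<-trans (m≤m+n (x i) (x j)) xi+xj<sum))
    j<l : j <ᶠ l
    j<l = x<⇒< (subst (x j <_) e (≤-<-trans (m≤n+m (x j) (x i)) xi+xj<sum))

  sum≢∣-∣ : ∀ {i j k l} → k ≢ l → x i + x j ≢ ∣ x k - x l ∣
  sum≢∣-∣ {i} {j} {k} {l} k≢l e with Fin.<-cmp k l
  ... | tri< k<l _ _ =
    sum-of-three≢larger k<l (trans (cong (_+ x k) e) (m≤n⇒∣m-n∣+m≡n (<⇒≤ (increasing k<l))))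
  ... | tri≈ _ k≡l _ = k≢l k≡l
  ... | tri> _ _ l<k =
    sum-of-three≢larger l<k (trans (cong (_+ x l) (trans e (∣-∣-comm (x k) (x l))))
                                   (m≤n⇒∣m-n∣+m≡n (<⇒≤ (increasing l<k))))

module Construction {n : ℕ} (B : Graph n) (colour : Fin n → Bool)
                    (proper : ∀ {i j} → Adj B i j → colour i ≢ colour j) where

  weight : Fin n → ℕ
  weight i = bit (colour i) + 2 * 4 ^ suc (toℕ i)

  open Dominant weight
    (λ i → bit+2*4^-positive (colour i) (toℕ i))
    (λ {i} {j} → bit+2*4^-dominant (colour i) (colour j))
    public

  Vertices : ℕ → Set
  Vertices a = Σ (Fin n) λ i → 2 * weight i ≡ a

  EdgeValues : ℕ → Set
  EdgeValues o = Σ (Fin n) λ k → Σ (Fin n) λ l →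
    Adj B k l × (weight k + weight l ≡ o ⊎ ∣ weight k - weight l ∣ ≡ o)

  weight-parity : ∀ i → Parity (colour i) (weight i)
  weight-parity i = bit+2*-parity (colour i) (4 ^ suc (toℕ i))

  edgeValue-odd : ∀ o → EdgeValues o → Odd o
  edgeValue-odd _ (k , l , kl , inj₁ refl) =
    opposite-parities⇒sum-odd (proper kl) (weight-parity k) (weight-parity l)
  edgeValue-odd _ (k , l , kl , inj₂ refl) =
    opposite-parities⇒∣-∣-odd (proper kl) (weight-parity k) (weight-parity l)

  preserves-adjacency : ∀ {i j} → Adj B i j → OEAdj EdgeValues (2 * weight i) (2 * weight j)
  preserves-adjacency {i} {j} ij =
      (λ e → irrefl B (subst (Adj B i) (sym (injective (*-cancelˡ-≡ _ _ 2 e))) ij))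
    , weight i + weight j , ∣ weight i - weight j ∣
    , sym (*-distribˡ-+ 2 (weight i) (weight j))
    , sym (*-distribˡ-∣-∣ 2 (weight i) (weight j))
    , (i , j , ij , inj₁ refl)
    , (i , j , ij , inj₂ refl)

  reflects-adjacency : ∀ {i j} → OEAdj EdgeValues (2 * weight i) (2 * weight j) → Adj B i j
  reflects-adjacency {i} {j} (_ , _ , _ , 2s≡ , _ , (k , l , kl , inj₂ ∣-∣≡s) , _) =
    ⊥-elim (sum≢∣-∣ (λ { refl → irrefl B kl })
                    (trans (halve-sum (weight i) (weight j) 2s≡) (sym ∣-∣≡s)))
  reflects-adjacency {i} {j} (_ , _ , _ , 2s≡ , _ , (k , l , kl , inj₁ sum≡s) , _)
    with sum-injective (trans (halve-sum (weight i) (weight j) 2s≡) (sym sum≡s))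
  ... | inj₁ (refl , refl) = kl
  ... | inj₂ (refl , refl) = Graph.sym B kl

mainTheorem2 : ∀ (n : ℕ) (B : Graph n) → Bipartite B →
    Σ (ℕ → Set) λ A → Σ (ℕ → Set) λ O →
      (∀ a → A a → Even a) × (∀ o → O o → Odd o × 0 < o) × IsoOE B A O
mainTheorem2 n B (colour , proper) =
    Vertices , EdgeValues
  , (λ { _ (i , refl) → weight i , refl })
  , (λ o o∈O → edgeValue-odd o o∈O , odd⇒positive (edgeValue-odd o o∈O))
  , (λ i → 2 * weight i)
  , (λ i → i , refl)
  , (λ i j → injective ∘ *-cancelˡ-≡ (weight i) (weight j) 2)
  , (λ _ a∈A → a∈A)
  , (λ i j → preserves-adjacency , reflects-adjacency)
  where open Construction B colour proper
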